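{- Let $A,B,C$ be uniform-iteration algebras, where $A\times B$ carries the componentwise structure $h^\dagger=\langle((\mathrm{fst}+\mathrm{id})h)^\dagger,((\mathrm{snd}+\mathrm{id})h)^\dagger\rangle$, and let $f\colon Z\to A\times B+Z$ and $h\colon A\times B\to C$. Then $$((h+\mathrm{id})f)^\dagger=\big((h+\mathrm{id})\,\mathrm{dstr}\,(\mathrm{id}\times(\mathrm{snd}+\mathrm{id})f)\big)^\dagger\circ\langle((\mathrm{fst}+\mathrm{id})f)^\dagger,\mathrm{id}\rangle,$$ where $(h+\mathrm{id})\,\mathrm{dstr}\,(\mathrm{id}\times(\mathrm{snd}+\mathrm{id})f)\colon A\times Z\to C+A\times Z$.
   Context: $\mathbf{C}$ is an extensive category with finite products; $\mathrm{dstr}\colon X\times(Y+W)\to X\times Y+X\times W$ is the canonical distributivity isomorphism. A uniform-iteration algebra is an object $A$ with an operator assigning to every $f\colon X\to A+X$ a morphism $f^\dagger\colon X\to A$ such that (Fixpoint) $f^\dagger=[\mathrm{id},f^\dagger]f$ and (Uniformity) for $f\colon X\to A+X$, $g\colon Y\to A+Y$, $h\colon X\to Y$, $(\mathrm{id}+h)f=gh$ implies $f^\dagger=g^\dagger h$. -}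

module Defs where

open import Level using (Level; _⊔_; suc)
open import Relation.Binary using (Rel; IsEquivalence)
open import Data.Product using (Σ; _,_)

record Category (o ℓ e : Level) : Set (suc (o ⊔ ℓ ⊔ e)) where
  infix  4 _≈_ _⇒_
  infixr 9 _∘_
  field
    Obj   : Set o
    _⇒_   : Obj → Obj → Set ℓ
    _≈_   : ∀ {A B} → Rel (A ⇒ B) e
    id    : ∀ {A} → A ⇒ A
    _∘_   : ∀ {A B C} → B ⇒ C → A ⇒ B → A ⇒ C
    equiv : ∀ {A B} → IsEquivalence (_≈_ {A} {B})
    assoc : ∀ {A B C D} {f : A ⇒ B} {g : B ⇒ C} {h : C ⇒ D} →
            (h ∘ g) ∘ f ≈ h ∘ (g ∘ f)
    identityˡ : ∀ {A B} {f : A ⇒ B} → id ∘ f ≈ f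
    identityʳ : ∀ {A B} {f : A ⇒ B} → f ∘ id ≈ f
    ∘-resp-≈  : ∀ {A B C} {f h : B ⇒ C} {g i : A ⇒ B} →
                f ≈ h → g ≈ i → f ∘ g ≈ h ∘ i

module _ {o ℓ e} (𝒞 : Category o ℓ e) where
  open Category 𝒞

  record IsPullback {P X Y Z : Obj} (p₁ : P ⇒ X) (p₂ : P ⇒ Y)
                    (f : X ⇒ Z) (g : Y ⇒ Z) : Set (o ⊔ ℓ ⊔ e) where
    field
      commute   : f ∘ p₁ ≈ g ∘ p₂
      universal : ∀ {Q} {h₁ : Q ⇒ X} {h₂ : Q ⇒ Y} → f ∘ h₁ ≈ g ∘ h₂ → Q ⇒ P
      p₁∘universal≈h₁ : ∀ {Q} {h₁ : Q ⇒ X} {h₂ : Q ⇒ Y} (eq : f ∘ h₁ ≈ g ∘ h₂) →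
                        p₁ ∘ universal eq ≈ h₁
      p₂∘universal≈h₂ : ∀ {Q} {h₁ : Q ⇒ X} {h₂ : Q ⇒ Y} (eq : f ∘ h₁ ≈ g ∘ h₂) →
                        p₂ ∘ universal eq ≈ h₂
      unique-diagram : ∀ {Q} {h i : Q ⇒ P} → p₁ ∘ h ≈ p₁ ∘ i → p₂ ∘ h ≈ p₂ ∘ i → h ≈ i

  record IsCoproduct {A B X : Obj} (i₁ : A ⇒ X) (i₂ : B ⇒ X) : Set (o ⊔ ℓ ⊔ e) where
    field
      [_,_]    : ∀ {C} → A ⇒ C → B ⇒ C → X ⇒ C
      inject₁  : ∀ {C} {f : A ⇒ C} {g : B ⇒ C} → [ f , g ] ∘ i₁ ≈ f
      inject₂  : ∀ {C} {f : A ⇒ C} {g : B ⇒ C} → [ f , g ] ∘ i₂ ≈ g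
      unique   : ∀ {C} {h : X ⇒ C} {f : A ⇒ C} {g : B ⇒ C} →
                 h ∘ i₁ ≈ f → h ∘ i₂ ≈ g → [ f , g ] ≈ h

  record IsInitial (I : Obj) : Set (o ⊔ ℓ ⊔ e) where
    field
      ¡        : ∀ {X} → I ⇒ X
      ¡-unique : ∀ {X} (g : I ⇒ X) → ¡ ≈ g

  record FiniteProducts : Set (o ⊔ ℓ ⊔ e) where
    infixr 7 _×ₒ_
    field
      ⊤      : Obj
      !      : ∀ {A} → A ⇒ ⊤
      !-unique : ∀ {A} (f : A ⇒ ⊤) → ! ≈ f
      _×ₒ_   : Obj → Obj → Obj
      π₁     : ∀ {A B} → A ×ₒ B ⇒ A
      π₂     : ∀ {A B} → A ×ₒ B ⇒ B
      ⟨_,_⟩  : ∀ {A B C} → C ⇒ A → C ⇒ B → C ⇒ A ×ₒ B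
      project₁ : ∀ {A B C} {f : C ⇒ A} {g : C ⇒ B} → π₁ ∘ ⟨ f , g ⟩ ≈ f
      project₂ : ∀ {A B C} {f : C ⇒ A} {g : C ⇒ B} → π₂ ∘ ⟨ f , g ⟩ ≈ g
      ⟨⟩-unique : ∀ {A B C} {h : C ⇒ A ×ₒ B} {f : C ⇒ A} {g : C ⇒ B} →
                  π₁ ∘ h ≈ f → π₂ ∘ h ≈ g → ⟨ f , g ⟩ ≈ h

    _⁂_ : ∀ {A B C D} → A ⇒ B → C ⇒ D → A ×ₒ C ⇒ B ×ₒ D
    f ⁂ g = ⟨ f ∘ π₁ , g ∘ π₂ ⟩

  record FiniteCoproducts : Set (o ⊔ ℓ ⊔ e) where
    infixr 6 _+ₒ_
    field
      ⊥      : Obj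
      ⊥-initial : IsInitial ⊥
      _+ₒ_   : Obj → Obj → Obj
      i₁     : ∀ {A B} → A ⇒ A +ₒ B
      i₂     : ∀ {A B} → B ⇒ A +ₒ B
      isCoproduct : ∀ {A B} → IsCoproduct (i₁ {A} {B}) (i₂ {A} {B})

    [_,_] : ∀ {A B C} → A ⇒ C → B ⇒ C → A +ₒ B ⇒ C
    [ f , g ] = IsCoproduct.[_,_] isCoproduct f g

    _+₁_ : ∀ {A B C D} → A ⇒ B → C ⇒ D → A +ₒ C ⇒ B +ₒ D
    f +₁ g = [ i₁ ∘ f , i₂ ∘ g ]

  record Extensive : Set (suc (o ⊔ ℓ ⊔ e)) where
    field
      coproducts : FiniteCoproducts
    open FiniteCoproducts coproducts
    field
      i₁-mono : ∀ {A B X} {f g : X ⇒ A} → i₁ {A} {B} ∘ f ≈ i₁ ∘ g → f ≈ g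
      i₂-mono : ∀ {A B X} {f g : X ⇒ B} → i₂ {A} {B} ∘ f ≈ i₂ ∘ g → f ≈ g
      disjoint : ∀ {A B} →
        IsPullback (IsInitial.¡ ⊥-initial {A}) (IsInitial.¡ ⊥-initial {B})
                   (i₁ {A} {B}) (i₂ {A} {B})
      pb₁ : ∀ {A B X} (f : X ⇒ A +ₒ B) →
        Σ Obj λ P → Σ (P ⇒ X) λ p → Σ (P ⇒ A) λ q → IsPullback p q f i₁
      pb₂ : ∀ {A B X} (f : X ⇒ A +ₒ B) →
        Σ Obj λ P → Σ (P ⇒ X) λ p → Σ (P ⇒ B) λ q → IsPullback p q f i₂
      universal : ∀ {A B X P₁ P₂} {f : X ⇒ A +ₒ B}
        {p₁ : P₁ ⇒ X} {q₁ : P₁ ⇒ A} {p₂ : P₂ ⇒ X} {q₂ : P₂ ⇒ B} →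
        IsPullback p₁ q₁ f i₁ → IsPullback p₂ q₂ f i₂ → IsCoproduct p₁ p₂

  -- The canonical map  X×Y + X×W → X×(Y+W),  whose inverse is dstr.
  module _ (P : FiniteProducts) (Co : FiniteCoproducts) where
    open FiniteProducts P
    open FiniteCoproducts Co

    distribute : ∀ {X Y W} → (X ×ₒ Y) +ₒ (X ×ₒ W) ⇒ X ×ₒ (Y +ₒ W)
    distribute = [ id ⁂ i₁ , id ⁂ i₂ ]

  module _ (Co : FiniteCoproducts) where
    open FiniteCoproducts Co

    record UniformIterationAlgebra (A : Obj) : Set (o ⊔ ℓ ⊔ e) where
      field
        _† : ∀ {X} → X ⇒ A +ₒ X → X ⇒ A
        †-resp-≈   : ∀ {X} {f g : X ⇒ A +ₒ X} → f ≈ g → f † ≈ g †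
        fixpoint   : ∀ {X} {f : X ⇒ A +ₒ X} → f † ≈ [ id , f † ] ∘ f
        uniformity : ∀ {X Y} {f : X ⇒ A +ₒ X} {g : Y ⇒ A +ₒ Y} {h : X ⇒ Y} →
                     (id +₁ h) ∘ f ≈ g ∘ h → f † ≈ g † ∘ h

-- Write a = ((π₁ +₁ id) ∘ f)† for the first component of the iteration of f.
-- By uniformity it suffices that k = ⟨ a , id ⟩ carries the loop (h +₁ id) ∘ f
-- to the loop over A × Z, i.e. that (id +₁ k) ∘ (h +₁ id) ∘ f equals
-- (h +₁ id) ∘ dstr ∘ (id ⁂ ((π₂ +₁ id) ∘ f)) ∘ k.  Both sides start with h +₁ id,
-- and after cancelling dstr against distribute the remaining identity
-- distribute ∘ (id +₁ k) ∘ f ≈ ⟨ a , (π₂ +₁ id) ∘ f ⟩ is the fixpoint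
-- equation a ≈ [ π₁ , a ] ∘ f read componentwise.
module Submission where

open import Defs
open import Relation.Binary using (Setoid)
import Relation.Binary.Reasoning.Setoid as SetoidReasoning

module HomReasoning {o ℓ e} (𝒞 : Category o ℓ e) where
  open Category 𝒞

  hom-setoid : Obj → Obj → Setoid ℓ e
  hom-setoid X Y = record { Carrier = X ⇒ Y ; _≈_ = _≈_ ; isEquivalence = equiv }

  module _ {X Y : Obj} where
    open Setoid (hom-setoid X Y) public using (refl; sym; trans)
    open SetoidReasoning (hom-setoid X Y) public

  ∘-resp-≈ˡ : ∀ {X Y W} {f g : Y ⇒ W} {h : X ⇒ Y} → f ≈ g → f ∘ h ≈ g ∘ h
  ∘-resp-≈ˡ p = ∘-resp-≈ p refl

  ∘-resp-≈ʳ : ∀ {X Y W} {f : Y ⇒ W} {g h : X ⇒ Y} → g ≈ h → f ∘ g ≈ f ∘ h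
  ∘-resp-≈ʳ p = ∘-resp-≈ refl p

module CoproductProperties {o ℓ e} {𝒞 : Category o ℓ e} (coproducts : FiniteCoproducts 𝒞) where
  open Category 𝒞
  open FiniteCoproducts coproducts
  open HomReasoning 𝒞
  private module Coproduct {X Y} = IsCoproduct (isCoproduct {X} {Y})

  []-cong : ∀ {X Y W} {f f′ : X ⇒ W} {g g′ : Y ⇒ W} →
            f ≈ f′ → g ≈ g′ → [ f , g ] ≈ [ f′ , g′ ]
  []-cong p q = sym (Coproduct.unique (trans Coproduct.inject₁ p) (trans Coproduct.inject₂ q))

  ∘-distribˡ-[] : ∀ {X Y W V} {f : X ⇒ W} {g : Y ⇒ W} {h : W ⇒ V} →
                  h ∘ [ f , g ] ≈ [ h ∘ f , h ∘ g ]
  ∘-distribˡ-[] = sym (Coproduct.unique (trans assoc (∘-resp-≈ʳ Coproduct.inject₁))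
                                        (trans assoc (∘-resp-≈ʳ Coproduct.inject₂)))

  []∘+₁ : ∀ {X Y X′ Y′ W} {f : X′ ⇒ W} {g : Y′ ⇒ W} {h : X ⇒ X′} {k : Y ⇒ Y′} →
          [ f , g ] ∘ (h +₁ k) ≈ [ f ∘ h , g ∘ k ]
  []∘+₁ = trans ∘-distribˡ-[]
                ([]-cong (trans (sym assoc) (∘-resp-≈ˡ Coproduct.inject₁))
                         (trans (sym assoc) (∘-resp-≈ˡ Coproduct.inject₂)))

  +₁∘+₁ : ∀ {X Y X′ Y′ X″ Y″} {f : X′ ⇒ X″} {g : Y′ ⇒ Y″} {h : X ⇒ X′} {k : Y ⇒ Y′} →
          (f +₁ g) ∘ (h +₁ k) ≈ (f ∘ h) +₁ (g ∘ k)
  +₁∘+₁ = trans []∘+₁ ([]-cong assoc assoc)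

  +₁-interchange : ∀ {X X′ Y Y′} {h : X ⇒ X′} {k : Y ⇒ Y′} →
                   (id +₁ k) ∘ (h +₁ id) ≈ (h +₁ id) ∘ (id +₁ k)
  +₁-interchange {h = h} {k} = begin
    (id +₁ k) ∘ (h +₁ id)   ≈⟨ +₁∘+₁ ⟩
    (id ∘ h) +₁ (k ∘ id)    ≈⟨ []-cong (∘-resp-≈ʳ (trans identityˡ (sym identityʳ)))
                                       (∘-resp-≈ʳ (trans identityʳ (sym identityˡ))) ⟩
    (h ∘ id) +₁ (id ∘ k)    ≈⟨ +₁∘+₁ ⟨
    (h +₁ id) ∘ (id +₁ k)   ∎

module ProductProperties {o ℓ e} {𝒞 : Category o ℓ e} (prod : FiniteProducts 𝒞) where
  open Category 𝒞
  open FiniteProducts prod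
  open HomReasoning 𝒞

  ⟨⟩-cong : ∀ {X Y W} {f f′ : W ⇒ X} {g g′ : W ⇒ Y} →
            f ≈ f′ → g ≈ g′ → ⟨ f , g ⟩ ≈ ⟨ f′ , g′ ⟩
  ⟨⟩-cong p q = sym (⟨⟩-unique (trans project₁ p) (trans project₂ q))

  ⟨⟩∘ : ∀ {X Y W V} {f : W ⇒ X} {g : W ⇒ Y} {h : V ⇒ W} →
        ⟨ f , g ⟩ ∘ h ≈ ⟨ f ∘ h , g ∘ h ⟩
  ⟨⟩∘ = sym (⟨⟩-unique (trans (sym assoc) (∘-resp-≈ˡ project₁))
                       (trans (sym assoc) (∘-resp-≈ˡ project₂)))

  ⁂∘⟨⟩ : ∀ {X Y X′ Y′ W} {f : X ⇒ X′} {g : Y ⇒ Y′} {p : W ⇒ X} {q : W ⇒ Y} →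
         (f ⁂ g) ∘ ⟨ p , q ⟩ ≈ ⟨ f ∘ p , g ∘ q ⟩
  ⁂∘⟨⟩ = trans ⟨⟩∘ (⟨⟩-cong (trans assoc (∘-resp-≈ʳ project₁))
                            (trans assoc (∘-resp-≈ʳ project₂)))

module Distributivity {o ℓ e} {𝒞 : Category o ℓ e}
                      (prod : FiniteProducts 𝒞) (coproducts : FiniteCoproducts 𝒞) where
  open Category 𝒞
  open FiniteProducts prod
  open FiniteCoproducts coproducts
  open HomReasoning 𝒞
  open CoproductProperties coproducts
  open ProductProperties prod
  private module Coproduct {X Y} = IsCoproduct (isCoproduct {X} {Y})

  ⟨[],[]⟩ : ∀ {X Y P Q} {p : X ⇒ P} {q : Y ⇒ P} {r : X ⇒ Q} {s : Y ⇒ Q} →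
            ⟨ [ p , q ] , [ r , s ] ⟩ ≈ [ ⟨ p , r ⟩ , ⟨ q , s ⟩ ]
  ⟨[],[]⟩ = sym (Coproduct.unique (trans ⟨⟩∘ (⟨⟩-cong Coproduct.inject₁ Coproduct.inject₁))
                                  (trans ⟨⟩∘ (⟨⟩-cong Coproduct.inject₂ Coproduct.inject₂)))

  distribute∘id+₁⟨-,id⟩ : ∀ {A B Z} {a : Z ⇒ A} →
    distribute 𝒞 prod coproducts {A} {B} {Z} ∘ (id +₁ ⟨ a , id ⟩) ≈ ⟨ [ π₁ , a ] , π₂ +₁ id ⟩
  distribute∘id+₁⟨-,id⟩ {a = a} = begin
    [ id ⁂ i₁ , id ⁂ i₂ ] ∘ (id +₁ ⟨ a , id ⟩)        ≈⟨ []∘+₁ ⟩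
    [ (id ⁂ i₁) ∘ id , (id ⁂ i₂) ∘ ⟨ a , id ⟩ ]       ≈⟨ []-cong (trans identityʳ (⟨⟩-cong identityˡ refl))
                                                                  (trans ⁂∘⟨⟩ (⟨⟩-cong identityˡ refl)) ⟩
    [ ⟨ π₁ , i₁ ∘ π₂ ⟩ , ⟨ a , i₂ ∘ id ⟩ ]            ≈⟨ ⟨[],[]⟩ ⟨
    ⟨ [ π₁ , a ] , [ i₁ ∘ π₂ , i₂ ∘ id ] ⟩            ∎

module IterationProperties {o ℓ e} {𝒞 : Category o ℓ e} (coproducts : FiniteCoproducts 𝒞) where
  open Category 𝒞
  open FiniteCoproducts coproducts
  open HomReasoning 𝒞
  open CoproductProperties coproducts

  module _ {A : Obj} (α : UniformIterationAlgebra 𝒞 coproducts A) where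
    open UniformIterationAlgebra α

    †-fixpoint-+₁ : ∀ {X Z} {g : X ⇒ A} {f : Z ⇒ X +ₒ Z} →
                    ((g +₁ id) ∘ f) † ≈ [ g , ((g +₁ id) ∘ f) † ] ∘ f
    †-fixpoint-+₁ {g = g} {f} = begin
      ((g +₁ id) ∘ f) †                            ≈⟨ fixpoint ⟩
      [ id , ((g +₁ id) ∘ f) † ] ∘ (g +₁ id) ∘ f   ≈⟨ assoc ⟨
      ([ id , ((g +₁ id) ∘ f) † ] ∘ (g +₁ id)) ∘ f ≈⟨ ∘-resp-≈ˡ (trans []∘+₁ ([]-cong identityˡ identityʳ)) ⟩
      [ g , ((g +₁ id) ∘ f) † ] ∘ f                ∎

module PairIteration {o ℓ e} {𝒞 : Category o ℓ e}
                     (coproducts : FiniteCoproducts 𝒞) (prod : FiniteProducts 𝒞) where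
  open Category 𝒞
  open FiniteCoproducts coproducts
  open FiniteProducts prod
  open HomReasoning 𝒞
  open ProductProperties prod
  open Distributivity prod coproducts
  open IterationProperties coproducts

  ⟨π₁-†,π₂-step⟩≈distribute : ∀ {A B Z} (α : UniformIterationAlgebra 𝒞 coproducts A)
    (f : Z ⇒ (A ×ₒ B) +ₒ Z) →
    let a = UniformIterationAlgebra._† α ((π₁ +₁ id) ∘ f) in
    ⟨ a , (π₂ +₁ id) ∘ f ⟩ ≈ distribute 𝒞 prod coproducts {A} {B} {Z} ∘ (id +₁ ⟨ a , id ⟩) ∘ f
  ⟨π₁-†,π₂-step⟩≈distribute {A} {B} {Z} α f = begin
    ⟨ a , (π₂ +₁ id) ∘ f ⟩                             ≈⟨ ⟨⟩-cong (†-fixpoint-+₁ α) refl ⟩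
    ⟨ [ π₁ , a ] ∘ f , (π₂ +₁ id) ∘ f ⟩                ≈⟨ ⟨⟩∘ ⟨
    ⟨ [ π₁ , a ] , π₂ +₁ id ⟩ ∘ f                      ≈⟨ ∘-resp-≈ˡ distribute∘id+₁⟨-,id⟩ ⟨
    (dist ∘ (id +₁ ⟨ a , id ⟩)) ∘ f                   ≈⟨ assoc ⟩
    dist ∘ (id +₁ ⟨ a , id ⟩) ∘ f                     ∎
    where
      a : Z ⇒ A
      a = UniformIterationAlgebra._† α ((π₁ +₁ id) ∘ f)
      dist : (A ×ₒ B) +ₒ (A ×ₒ Z) ⇒ A ×ₒ (B +ₒ Z)
      dist = distribute 𝒞 prod coproducts

lemma5p8 : ∀ {o ℓ e} (𝒞 : Category o ℓ e) (ext : Extensive 𝒞) (prod : FiniteProducts 𝒞) →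
    let open Category 𝒞
        open Extensive ext using (coproducts)
        open FiniteCoproducts coproducts
        open FiniteProducts prod
        UIA = UniformIterationAlgebra 𝒞 coproducts
        dist = distribute 𝒞 prod coproducts
    in ∀ {A B C Z : Obj} (α : UIA A) (β : UIA B) (γ : UIA C)
         (f : Z ⇒ (A ×ₒ B) +ₒ Z) (h : A ×ₒ B ⇒ C)
         (dstr : A ×ₒ (B +ₒ Z) ⇒ (A ×ₒ B) +ₒ (A ×ₒ Z)) →
         dstr ∘ dist ≈ id → dist ∘ dstr ≈ id →
         UniformIterationAlgebra._† γ ((h +₁ id) ∘ f)
           ≈ UniformIterationAlgebra._† γ ((h +₁ id) ∘ dstr ∘ (id ⁂ ((π₂ +₁ id) ∘ f)))
             ∘ ⟨ UniformIterationAlgebra._† α ((π₁ +₁ id) ∘ f) , id ⟩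
lemma5p8 𝒞 ext prod {A} {B} {C} {Z} α β γ f h dstr dstr∘dist≈id _ = uniformity (begin
    (id +₁ k) ∘ (h +₁ id) ∘ f                        ≈⟨ assoc ⟨
    ((id +₁ k) ∘ (h +₁ id)) ∘ f                      ≈⟨ ∘-resp-≈ˡ +₁-interchange ⟩
    ((h +₁ id) ∘ (id +₁ k)) ∘ f                      ≈⟨ assoc ⟩
    (h +₁ id) ∘ (id +₁ k) ∘ f                        ≈⟨ ∘-resp-≈ʳ (trans (sym identityˡ)
                                                                      (∘-resp-≈ˡ (sym dstr∘dist≈id))) ⟩
    (h +₁ id) ∘ (dstr ∘ dist) ∘ (id +₁ k) ∘ f        ≈⟨ ∘-resp-≈ʳ (trans assoc (∘-resp-≈ʳ
                                                          (sym (⟨π₁-†,π₂-step⟩≈distribute α f)))) ⟩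
    (h +₁ id) ∘ dstr ∘ ⟨ a , (π₂ +₁ id) ∘ f ⟩        ≈⟨ ∘-resp-≈ʳ (∘-resp-≈ʳ
                                                          (trans ⁂∘⟨⟩ (⟨⟩-cong identityˡ identityʳ))) ⟨
    (h +₁ id) ∘ dstr ∘ (id ⁂ ((π₂ +₁ id) ∘ f)) ∘ k   ≈⟨ trans (∘-resp-≈ʳ (sym assoc)) (sym assoc) ⟩
    ((h +₁ id) ∘ dstr ∘ (id ⁂ ((π₂ +₁ id) ∘ f))) ∘ k ∎)
  where
    open Category 𝒞
    open Extensive ext using (coproducts)
    open FiniteCoproducts coproducts
    open FiniteProducts prod
    open UniformIterationAlgebra γ using (uniformity)
    open HomReasoning 𝒞
    open CoproductProperties coproducts
    open ProductProperties prod
    open PairIteration coproducts prod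
    dist : (A ×ₒ B) +ₒ (A ×ₒ Z) ⇒ A ×ₒ (B +ₒ Z)
    dist = distribute 𝒞 prod coproducts
    a : Z ⇒ A
    a = UniformIterationAlgebra._† α ((π₁ +₁ id) ∘ f)
    k : Z ⇒ A ×ₒ Z
    k = ⟨ a , id ⟩
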